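{- Let $G$ be a $C_4$-component with $m(G)<m_2(C_4)=3/2$, and let $(H_1,\dots,H_t)$ be a construction sequence of $G$. If step $i$ is of type $(B_3)$ for some $i\in[t-1]$, then every step $j\in[t-1]\setminus\{i\}$ is of type $(A_2)$.
   Context: $m(G)=\max\{e(J)/v(J):J\subseteq G,\ v(J)\ge1\}$, $m_2(G)=\max\{(e(J)-1)/(v(J)-2):J\subseteq G,\ v(J)\ge3\}$. For graphs $G,F$, $\mathcal C_F(G)$ is the graph whose vertices are the copies of $F$ in $G$, two distinct copies adjacent if they share an edge; "$G$ is a $C_4$-component" means $G$ is the union of its $4$-cycles and $\mathcal C_{C_4}(G)$ is connected. A construction sequence of $G$ is a sequence $H_1\subseteq\dots\subseteq H_t=G$ where $H_1$ is a $4$-cycle in $G$ and for each $i\in[t-1]$ there is a $4$-cycle $C$ in $G$ with $C\not\subseteq H_i$, $E(C)\cap E(H_i)\neq\emptyset$ and $H_{i+1}=H_i\cup C$. A $j$-path is a path with $j$ vertices. With $\ell=4$: step $i$ is of type $(A_j)$ ($2\le j\le 4$) if this cycle admits a labelling $C=u_1u_2\cdots u_\ell u_1$ with $u_1\cdots u_j$ a $j$-path in $H_i$ and $u_{j+1},\dots,u_\ell\notin V(H_i)$; step $i$ is of type $(B_k)$ ($3\le k\le\ell-1$) if $C$ admits a labelling with $u_1u_2\in E(H_i)$, $u_2u_3\notin E(H_i)$, $u_k\in V(H_i)$ and $\{u_3,\dots,u_\ell\}\setminus\{u_k\}\subseteq V(H_{i+1})\setminus V(H_i)$. -}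

module Defs where

open import Data.Nat using (ℕ; zero; suc; _+_; _*_; _<_; _≤_; _<ᵇ_)
open import Data.Fin using (Fin; zero; suc; toℕ)
open import Data.Bool using (Bool; true; false; if_then_else_; _∧_)
open import Data.Product using (Σ; ∃; ∃-syntax; _×_; _,_)
open import Data.Sum using (_⊎_)
open import Relation.Binary.PropositionalEquality using (_≡_; _≢_)
open import Relation.Nullary using (¬_)
open import Relation.Binary.Construct.Closure.ReflexiveTransitive using (Star)

record Graph (n : ℕ) : Set where
  field
    adj   : Fin n → Fin n → Bool
    sym   : ∀ x y → adj x y ≡ true → adj y x ≡ true
    irrefl : ∀ x → adj x x ≡ false
open Graph public

sumF : ∀ {n} → (Fin n → ℕ) → ℕ
sumF {zero}  f = 0
sumF {suc n} f = f zero + sumF (λ i → f (suc i))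

countF : ∀ {n} → (Fin n → Bool) → ℕ
countF f = sumF (λ i → if f i then 1 else 0)

record Subgraph {n : ℕ} (G : Graph n) : Set where
  field
    vJ    : Fin n → Bool
    eJ    : Fin n → Fin n → Bool
    eSym  : ∀ x y → eJ x y ≡ true → eJ y x ≡ true
    eAdj  : ∀ x y → eJ x y ≡ true → adj G x y ≡ true
    eEnds : ∀ x y → eJ x y ≡ true → vJ x ≡ true
open Subgraph public

vcount : ∀ {n} {G : Graph n} → Subgraph G → ℕ
vcount J = countF (vJ J)

-- edges counted as unordered pairs {x,y} with x < y
ecount : ∀ {n} {G : Graph n} → Subgraph G → ℕ
ecount J = sumF (λ x → countF (λ y → (toℕ x <ᵇ toℕ y) ∧ eJ J x y))

-- m(G) < 3/2, i.e. e(J)/v(J) < 3/2 for every subgraph J with v(J) ≥ 1,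
-- written without division as 2·e(J) < 3·v(J).
mLessThreeHalves : ∀ {n} → Graph n → Set
mLessThreeHalves G = (J : Subgraph G) → 1 ≤ vcount J → 2 * ecount J < 3 * vcount J

record Cycle4 {n : ℕ} (G : Graph n) : Set where
  field
    c1 c2 c3 c4 : Fin n
    d12 : c1 ≢ c2
    d13 : c1 ≢ c3
    d14 : c1 ≢ c4
    d23 : c2 ≢ c3
    d24 : c2 ≢ c4
    d34 : c3 ≢ c4
    e12 : adj G c1 c2 ≡ true
    e23 : adj G c2 c3 ≡ true
    e34 : adj G c3 c4 ≡ true
    e41 : adj G c4 c1 ≡ true
open Cycle4 public

QuadEdge : ∀ {n} → Fin n → Fin n → Fin n → Fin n → Fin n → Fin n → Set
QuadEdge u1 u2 u3 u4 x y =
  ((x ≡ u1 × y ≡ u2) ⊎ (x ≡ u2 × y ≡ u1)) ⊎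
  ((x ≡ u2 × y ≡ u3) ⊎ (x ≡ u3 × y ≡ u2)) ⊎
  ((x ≡ u3 × y ≡ u4) ⊎ (x ≡ u4 × y ≡ u3)) ⊎
  ((x ≡ u4 × y ≡ u1) ⊎ (x ≡ u1 × y ≡ u4))

QuadVertex : ∀ {n} → Fin n → Fin n → Fin n → Fin n → Fin n → Set
QuadVertex u1 u2 u3 u4 x = x ≡ u1 ⊎ x ≡ u2 ⊎ x ≡ u3 ⊎ x ≡ u4

CEdge : ∀ {n} {G : Graph n} → Cycle4 G → Fin n → Fin n → Set
CEdge C = QuadEdge (c1 C) (c2 C) (c3 C) (c4 C)

CVertex : ∀ {n} {G : Graph n} → Cycle4 G → Fin n → Set
CVertex C = QuadVertex (c1 C) (c2 C) (c3 C) (c4 C)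

Labelling : ∀ {n} {G : Graph n} → Cycle4 G → Fin n → Fin n → Fin n → Fin n → Set
Labelling C u1 u2 u3 u4 =
  (u1 ≢ u2 × u1 ≢ u3 × u1 ≢ u4 × u2 ≢ u3 × u2 ≢ u4 × u3 ≢ u4) ×
  (∀ x y → (CEdge C x y → QuadEdge u1 u2 u3 u4 x y) × (QuadEdge u1 u2 u3 u4 x y → CEdge C x y))

-- two copies of C4 are adjacent in 𝒞_{C4}(G) iff they share an edge
ShareEdge : ∀ {n} {G : Graph n} → Cycle4 G → Cycle4 G → Set
ShareEdge C D = ∃[ x ] ∃[ y ] (CEdge C x y × CEdge D x y)

IsC4Component : ∀ {n} → Graph n → Set
IsC4Component {n} G =
  -- G is the union of its 4-cycles
  (∀ (x : Fin n) → ∃[ C ] CVertex {G = G} C x) ×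
  (∀ (x y : Fin n) → adj G x y ≡ true → ∃[ C ] CEdge {G = G} C x y) ×
  -- 𝒞_{C4}(G) is connected
  (∀ (C D : Cycle4 G) → Star ShareEdge C D)

-- A sequence is given by the 4-cycles cyc 0, …, cyc (t-1) of G:
--   H_1 = cyc 0,  H_{i+1} = H_i ∪ cyc i  (1 ≤ i ≤ t-1),
-- so H_i = cyc 0 ∪ … ∪ cyc (i-1) and step i adds the cycle cyc i.

module _ {n : ℕ} {G : Graph n} {t : ℕ} (cyc : Fin t → Cycle4 G) where

  VH : ℕ → Fin n → Set
  VH i x = ∃[ k ] (toℕ k < i × CVertex (cyc k) x)

  EH : ℕ → Fin n → Fin n → Set
  EH i x y = ∃[ k ] (toℕ k < i × CEdge (cyc k) x y)

record ConstructionSequence {n : ℕ} (G : Graph n) : Set where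
  field
    t      : ℕ
    t≥1    : 1 ≤ t
    cyc    : Fin t → Cycle4 G
    notSub : ∀ (i : Fin t) → 1 ≤ toℕ i →
               ¬ ((∀ x → CVertex (cyc i) x → VH cyc (toℕ i) x) ×
                  (∀ x y → CEdge (cyc i) x y → EH cyc (toℕ i) x y))
    meets  : ∀ (i : Fin t) → 1 ≤ toℕ i →
               ∃[ x ] ∃[ y ] (CEdge (cyc i) x y × EH cyc (toℕ i) x y)
    lastV  : ∀ x → VH cyc t x
    lastE  : ∀ x y → (adj G x y ≡ true → EH cyc t x y) × (EH cyc t x y → adj G x y ≡ true)
open ConstructionSequence public

module _ {n : ℕ} {G : Graph n} (S : ConstructionSequence G) where

  TypeA2 : Fin (t S) → Set
  TypeA2 i = ∃[ u1 ] ∃[ u2 ] ∃[ u3 ] ∃[ u4 ]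
    (Labelling (cyc S i) u1 u2 u3 u4 ×
     VH (cyc S) (toℕ i) u1 × VH (cyc S) (toℕ i) u2 × EH (cyc S) (toℕ i) u1 u2 ×
     ¬ VH (cyc S) (toℕ i) u3 × ¬ VH (cyc S) (toℕ i) u4)

  TypeB3 : Fin (t S) → Set
  TypeB3 i = ∃[ u1 ] ∃[ u2 ] ∃[ u3 ] ∃[ u4 ]
    (Labelling (cyc S i) u1 u2 u3 u4 ×
     EH (cyc S) (toℕ i) u1 u2 × ¬ EH (cyc S) (toℕ i) u2 u3 ×
     VH (cyc S) (toℕ i) u3 ×
     VH (cyc S) (suc (toℕ i)) u4 × ¬ VH (cyc S) (toℕ i) u4)

module Submission where

-- Write v(H) and e(H) for the numbers of vertices and edges of H. A step that adds a 4-cycle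
-- with N new vertices and M new edges lowers 3v − 2e by 2M − 3N. Every edge at a new vertex is
-- new, and the cycle has both an edge in H_i and an edge outside H_i; checking the 2⁸ possible
-- patterns gives 3N ≤ 2M, with 3N + 1 ≤ 2M unless the step is of type (A₂), and 3N + 3 ≤ 2M
-- for a step of type (B₃). Since 3v(H₁) − 2e(H₁) ≤ 4, a step of type (B₃) together with another
-- step not of type (A₂) forces 3v(G) ≤ 2e(G), whereas m(G) < 3/2 applied to J = G itself
-- gives 2e(G) < 3v(G).

open import Defs hiding (sym)
open import Algebra.Properties.CommutativeSemigroup using (interchange)
open import Data.Bool using (Bool; true; false; if_then_else_; _∧_; _∨_; T)
open import Data.Bool.Properties using (T-∧; T-≡; ∧-distribˡ-∨)
open import Data.Empty using (⊥-elim)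
open import Data.Fin using (Fin; zero; suc; toℕ; _≟_; fromℕ<)
open import Data.Fin.Properties using (suc-injective; 0≢1+n; <-cmp; any?; toℕ-injective; toℕ-fromℕ<; toℕ<n)
open import Data.List using (List; []; _∷_; map)
open import Data.List.Relation.Unary.All using (All; []; _∷_; lookupWith)
open import Data.List.Relation.Unary.AllPairs using (AllPairs; []; _∷_)
open import Data.List.Relation.Unary.Any using (Any; here; there)
import Data.List.Relation.Unary.Any as Any
import Data.List.Membership.DecPropositional as DecMembership
open import Data.Nat using (ℕ; zero; suc; _+_; _*_; _≤_; _<_; _<ᵇ_; _≡ᵇ_; z≤n; s≤s; s≤s⁻¹; _≤?_; _<?_)
open import Data.Nat.ListAction using (sum)
open import Data.Nat.Properties
  using ( ≤-refl; ≤-trans; ≤-reflexive; <⇒≤; <⇒≱; m≤m+n; m≤n+m; m≤n⇒m≤1+n; m≤n⇒m<n∨m≡n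
        ; +-mono-≤; +-monoˡ-≤; +-monoʳ-≤; *-monoʳ-≤; +-identityʳ; +-cancelˡ-≤; +-cancelʳ-≤
        ; <⇒<ᵇ; ≡ᵇ⇒≡; +-commutativeSemigroup; module ≤-Reasoning )
open import Data.Nat.Tactic.RingSolver using (solve-∀)
open import Data.Product using (_×_; _,_; proj₁; proj₂; uncurry)
import Data.Product as Product
open import Data.Sum using (_⊎_; inj₁; inj₂; [_,_]′)
import Data.Sum as Sum
open import Data.Vec using (Vec; []; _∷_)
open import Function using (_∘_)
open import Function.Bundles using (Equivalence)
open import Relation.Binary.Definitions using (tri<; tri≈; tri>)
open import Relation.Binary.PropositionalEquality using (_≡_; _≢_; refl; sym; cong; cong₂; trans; subst)
open import Relation.Nullary using (¬_; Dec; yes; no; does)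
open import Relation.Nullary.Decidable using (_⊎-dec_; _×-dec_; _→-dec_; ¬?; map′; T?; decidable-stable)

open Equivalence using (to; from)
open module FinMembership {n : ℕ} = DecMembership (_≟_ {n}) using (_∈?_)

does-sound : ∀ {a} {A : Set a} (A? : Dec A) → T (does A?) → A
does-sound (yes a) _ = a
does-sound (no _) ()

does-complete : ∀ {a} {A : Set a} (A? : Dec A) → A → T (does A?)
does-complete (yes _) _ = _
does-complete (no ¬a) a = ¬a a

𝟙 : Bool → ℕ
𝟙 b = if b then 1 else 0

𝟙-mono : ∀ {a b} → (T a → T b) → 𝟙 a ≤ 𝟙 b
𝟙-mono {false} _ = z≤n
𝟙-mono {true} {true} _ = ≤-refl
𝟙-mono {true} {false} a⇒b = ⊥-elim (a⇒b _)

𝟙-∨ : ∀ a b → 𝟙 (a ∨ b) ≤ 𝟙 a + 𝟙 b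
𝟙-∨ false b = ≤-refl
𝟙-∨ true b = s≤s z≤n

𝟙-∨-disjoint : ∀ a b → (T a → ¬ T b) → 𝟙 a + 𝟙 b ≤ 𝟙 (a ∨ b)
𝟙-∨-disjoint false b _ = ≤-refl
𝟙-∨-disjoint true false _ = ≤-refl
𝟙-∨-disjoint true true a#b = ⊥-elim (a#b _ _)

𝟙-T : ∀ {b} → T b → 𝟙 b ≡ 1
𝟙-T {true} _ = refl

sumF-mono : ∀ {n} {f g : Fin n → ℕ} → (∀ x → f x ≤ g x) → sumF f ≤ sumF g
sumF-mono {zero} f≤g = z≤n
sumF-mono {suc n} f≤g = +-mono-≤ (f≤g zero) (sumF-mono (f≤g ∘ suc))

sumF-cong : ∀ {n} {f g : Fin n → ℕ} → (∀ x → f x ≡ g x) → sumF f ≡ sumF g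
sumF-cong {zero} f≡g = refl
sumF-cong {suc n} f≡g = cong₂ _+_ (f≡g zero) (sumF-cong (f≡g ∘ suc))

sumF-+ : ∀ {n} (f g : Fin n → ℕ) → sumF (λ x → f x + g x) ≡ sumF f + sumF g
sumF-+ {zero} f g = refl
sumF-+ {suc n} f g =
  trans (cong (f zero + g zero +_) (sumF-+ (f ∘ suc) (g ∘ suc)))
        (interchange +-commutativeSemigroup (f zero) (g zero) (sumF (f ∘ suc)) (sumF (g ∘ suc)))

term≤sumF : ∀ {n} (f : Fin n → ℕ) (a : Fin n) → f a ≤ sumF f
term≤sumF f zero = m≤m+n _ _
term≤sumF f (suc a) = ≤-trans (term≤sumF (f ∘ suc) a) (m≤n+m _ (f zero))

countF-none : ∀ {n} {f : Fin n → Bool} → (∀ x → ¬ T (f x)) → countF f ≡ 0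
countF-none {zero} _ = refl
countF-none {suc n} {f} none with f zero | none zero
... | false | _ = countF-none (none ∘ suc)
... | true | ¬⊤ = ⊥-elim (¬⊤ _)

countF-mono : ∀ {n} {f g : Fin n → Bool} → (∀ x → T (f x) → T (g x)) → countF f ≤ countF g
countF-mono f⇒g = sumF-mono (λ x → 𝟙-mono (f⇒g x))

countF-∨ : ∀ {n} (f g : Fin n → Bool) → countF (λ x → f x ∨ g x) ≤ countF f + countF g
countF-∨ f g = ≤-trans (sumF-mono (λ x → 𝟙-∨ (f x) (g x))) (≤-reflexive (sumF-+ (𝟙 ∘ f) (𝟙 ∘ g)))

countF-∨-disjoint : ∀ {n} (f g : Fin n → Bool) → (∀ x → T (f x) → ¬ T (g x)) →
                    countF f + countF g ≤ countF (λ x → f x ∨ g x)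
countF-∨-disjoint f g f#g =
  ≤-trans (≤-reflexive (sym (sumF-+ (𝟙 ∘ f) (𝟙 ∘ g)))) (sumF-mono (λ x → 𝟙-∨-disjoint (f x) (g x) (f#g x)))

countF-single : ∀ {n} {f : Fin n → Bool} (a : Fin n) → (∀ x → T (f x) → x ≡ a) → countF f ≤ 𝟙 (f a)
countF-single {f = f} zero only-a =
  ≤-reflexive (trans (cong (𝟙 (f zero) +_) (countF-none (λ x fx → 0≢1+n (sym (only-a (suc x) fx)))))
                     (+-identityʳ _))
countF-single {f = f} (suc a) only-a with f zero in f0
... | true = ⊥-elim (0≢1+n (only-a zero (subst T (sym f0) _)))
... | false = countF-single a (λ x fx → suc-injective (only-a (suc x) fx))

countF-∧-∈≤sum : ∀ {n} (f : Fin n → Bool) (xs : List (Fin n)) →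
                 countF (λ x → f x ∧ does (x ∈? xs)) ≤ sum (map (𝟙 ∘ f) xs)
countF-∧-∈≤sum f [] = ≤-reflexive (countF-none (λ x → proj₂ ∘ T-∧ {f x} .to))
countF-∧-∈≤sum f (a ∷ xs) = begin
  countF (λ x → f x ∧ (does (x ≟ a) ∨ does (x ∈? xs)))
    ≡⟨ sumF-cong (λ x → cong 𝟙 (∧-distribˡ-∨ (f x) (does (x ≟ a)) (does (x ∈? xs)))) ⟩
  countF (λ x → (f x ∧ does (x ≟ a)) ∨ (f x ∧ does (x ∈? xs)))
    ≤⟨ countF-∨ (λ x → f x ∧ does (x ≟ a)) (λ x → f x ∧ does (x ∈? xs)) ⟩
  countF (λ x → f x ∧ does (x ≟ a)) + countF (λ x → f x ∧ does (x ∈? xs))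
    ≤⟨ +-mono-≤ (countF-single a (λ x h → does-sound (x ≟ a) (proj₂ (T-∧ {f x} .to h)))) (countF-∧-∈≤sum f xs) ⟩
  𝟙 (f a ∧ does (a ≟ a)) + sum (map (𝟙 ∘ f) xs)
    ≤⟨ +-monoˡ-≤ _ (𝟙-mono {f a ∧ does (a ≟ a)} (proj₁ ∘ T-∧ .to)) ⟩
  𝟙 (f a) + sum (map (𝟙 ∘ f) xs)
    ∎
  where open ≤-Reasoning

∧-monoʳ : ∀ a {b c} → (T b → T c) → T (a ∧ b) → T (a ∧ c)
∧-monoʳ true b⇒c = b⇒c

countPairs : ∀ {n} → (Fin n → Fin n → Bool) → ℕ
countPairs f = sumF (λ x → countF (λ y → (toℕ x <ᵇ toℕ y) ∧ f x y))

countPairs-mono : ∀ {n} {f g : Fin n → Fin n → Bool} → (∀ x y → T (f x y) → T (g x y)) →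
                  countPairs f ≤ countPairs g
countPairs-mono f⇒g = sumF-mono (λ x → countF-mono (λ y → ∧-monoʳ (toℕ x <ᵇ toℕ y) (f⇒g x y)))

countPairs-∨-disjoint : ∀ {n} (f g : Fin n → Fin n → Bool) → (∀ x y → T (f x y) → ¬ T (g x y)) →
                        countPairs f + countPairs g ≤ countPairs (λ x y → f x y ∨ g x y)
countPairs-∨-disjoint f g f#g = begin
  countPairs f + countPairs g
    ≡⟨ sym (sumF-+ (countF ∘ row f) (countF ∘ row g)) ⟩
  sumF (λ x → countF (row f x) + countF (row g x))
    ≤⟨ sumF-mono (λ x → countF-∨-disjoint (row f x) (row g x) (row-disjoint x)) ⟩
  sumF (λ x → countF (λ y → row f x y ∨ row g x y))
    ≡⟨ sumF-cong (λ x → sumF-cong (λ y → cong 𝟙 (sym (∧-distribˡ-∨ (toℕ x <ᵇ toℕ y) (f x y) (g x y))))) ⟩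
  countPairs (λ x y → f x y ∨ g x y)
    ∎
  where
  open ≤-Reasoning
  row : (Fin _ → Fin _ → Bool) → Fin _ → Fin _ → Bool
  row h x y = (toℕ x <ᵇ toℕ y) ∧ h x y
  row-disjoint : ∀ x y → T (row f x y) → ¬ T (row g x y)
  row-disjoint x y with toℕ x <ᵇ toℕ y
  ... | true = f#g x y

𝟙≤countPairs : ∀ {n} (f : Fin n → Fin n → Bool) {a b : Fin n} → toℕ a < toℕ b → 𝟙 (f a b) ≤ countPairs f
𝟙≤countPairs f {a} {b} a<b = begin
  𝟙 (f a b)                               ≤⟨ 𝟙-mono {f a b} (λ fab → T-∧ .from (<⇒<ᵇ a<b , fab)) ⟩
  𝟙 ((toℕ a <ᵇ toℕ b) ∧ f a b)            ≤⟨ term≤sumF (λ y → 𝟙 ((toℕ a <ᵇ toℕ y) ∧ f a y)) b ⟩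
  countF (λ y → (toℕ a <ᵇ toℕ y) ∧ f a y) ≤⟨ term≤sumF (λ x → countF (λ y → (toℕ x <ᵇ toℕ y) ∧ f x y)) a ⟩
  countPairs f                            ∎
  where open ≤-Reasoning

𝟙≤countPairs-sym : ∀ {n} (f : Fin n → Fin n → Bool) → (∀ x y → T (f x y) → T (f y x)) →
                   ∀ {a b} → a ≢ b → 𝟙 (f a b) ≤ countPairs f
𝟙≤countPairs-sym f f-sym {a} {b} a≢b with <-cmp a b
... | tri< a<b _ _ = 𝟙≤countPairs f a<b
... | tri≈ _ a≡b _ = ⊥-elim (a≢b a≡b)
... | tri> _ _ b<a = ≤-trans (𝟙-mono {f a b} (f-sym a b)) (𝟙≤countPairs f b<a)

Endpoints : ∀ {n} → Fin n × Fin n → Fin n → Fin n → Set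
Endpoints (a , b) x y = (x ≡ a × y ≡ b) ⊎ (x ≡ b × y ≡ a)

endpoints? : ∀ {n} (e : Fin n × Fin n) (x y : Fin n) → Dec (Endpoints e x y)
endpoints? (a , b) x y = (x ≟ a ×-dec y ≟ b) ⊎-dec (x ≟ b ×-dec y ≟ a)

Endpoints-sym : ∀ {n} {e : Fin n × Fin n} {x y} → Endpoints e x y → Endpoints e y x
Endpoints-sym (inj₁ (x≡a , y≡b)) = inj₂ (y≡b , x≡a)
Endpoints-sym (inj₂ (x≡b , y≡a)) = inj₁ (y≡a , x≡b)

Endpoints-unique : ∀ {n} {a b c d x y : Fin n} → Endpoints (a , b) x y → Endpoints (c , d) x y →
                   (a ≡ c × b ≡ d) ⊎ (a ≡ d × b ≡ c)
Endpoints-unique (inj₁ (refl , refl)) (inj₁ (refl , refl)) = inj₁ (refl , refl)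
Endpoints-unique (inj₁ (refl , refl)) (inj₂ (refl , refl)) = inj₂ (refl , refl)
Endpoints-unique (inj₂ (refl , refl)) (inj₁ (refl , refl)) = inj₂ (refl , refl)
Endpoints-unique (inj₂ (refl , refl)) (inj₂ (refl , refl)) = inj₁ (refl , refl)

Apart : ∀ {n} → Fin n × Fin n → Fin n × Fin n → Set
Apart e e′ = ∀ {x y} → Endpoints e x y → ¬ Endpoints e′ x y

apart : ∀ {n} {a b c d : Fin n} → ¬ (a ≡ c × b ≡ d) → ¬ (a ≡ d × b ≡ c) → Apart (a , b) (c , d)
apart ≢cd ≢dc e₁ e₂ = [ ≢cd , ≢dc ]′ (Endpoints-unique e₁ e₂)

onEdges : ∀ {n} → List (Fin n × Fin n) → Fin n → Fin n → Bool
onEdges es x y = does (Any.any? (λ e → endpoints? e x y) es)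

sum≤countPairs-onEdges : ∀ {n} (f : Fin n → Fin n → Bool) → (∀ x y → T (f x y) → T (f y x)) →
  (es : List (Fin n × Fin n)) → All (uncurry _≢_) es → AllPairs Apart es →
  sum (map (uncurry λ a b → 𝟙 (f a b)) es) ≤ countPairs (λ x y → f x y ∧ onEdges es x y)
sum≤countPairs-onEdges f f-sym [] [] [] = z≤n
sum≤countPairs-onEdges f f-sym ((a , b) ∷ es) (a≢b ∷ proper) (apart-e ∷ apart-es) = begin
  𝟙 (f a b) + sum (map (uncurry λ a b → 𝟙 (f a b)) es)
    ≤⟨ +-mono-≤ (≤-trans (𝟙-mono {f a b} (λ fab → T-∧ .from (fab , at-e (inj₁ (refl , refl)))))
                         (𝟙≤countPairs-sym on-e on-e-sym a≢b))
                (sum≤countPairs-onEdges f f-sym es proper apart-es) ⟩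
  countPairs on-e + countPairs on-es
    ≤⟨ countPairs-∨-disjoint on-e on-es disjoint ⟩
  countPairs (λ x y → on-e x y ∨ on-es x y)
    ≡⟨ sumF-cong (λ x → sumF-cong (λ y → cong (λ b → 𝟙 ((toℕ x <ᵇ toℕ y) ∧ b))
                                             (sym (∧-distribˡ-∨ (f x y) _ _)))) ⟩
  countPairs (λ x y → f x y ∧ onEdges ((a , b) ∷ es) x y)
    ∎
  where
  open ≤-Reasoning
  at-e : ∀ {x y} → Endpoints (a , b) x y → T (does (endpoints? (a , b) x y))
  at-e {x} {y} = does-complete (endpoints? (a , b) x y)
  on-e on-es : Fin _ → Fin _ → Bool
  on-e x y = f x y ∧ does (endpoints? (a , b) x y)
  on-es x y = f x y ∧ onEdges es x y
  on-e-sym : ∀ x y → T (on-e x y) → T (on-e y x)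
  on-e-sym x y h with T-∧ {f x y} .to h
  ... | fxy , exy = T-∧ .from (f-sym x y fxy , at-e (Endpoints-sym (does-sound (endpoints? (a , b) x y) exy)))
  disjoint : ∀ x y → T (on-e x y) → ¬ T (on-es x y)
  disjoint x y h h′ =
    lookupWith (λ apart e′ → apart (does-sound (endpoints? (a , b) x y) (proj₂ (T-∧ {f x y} .to h))) e′) apart-e
               (does-sound (Any.any? (λ e → endpoints? e x y) es) (proj₂ (T-∧ {f x y} .to h′)))

∀-Vec? : ∀ {p} k {P : Vec Bool k → Set p} → (∀ v → Dec (P v)) → Dec (∀ v → P v)
∀-Vec? zero P? = map′ (λ p → λ { [] → p }) (λ h → h []) (P? [])
∀-Vec? (suc k) P? =
  map′ (λ (h₀ , h₁) → λ { (false ∷ v) → h₀ v ; (true ∷ v) → h₁ v })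
       (λ h → h ∘ (false ∷_) , h ∘ (true ∷_))
       (∀-Vec? k (P? ∘ (false ∷_)) ×-dec ∀-Vec? k (P? ∘ (true ∷_)))

-- The profile of a step with respect to a labelling u₁u₂u₃u₄ of the added cycle records whether
-- u₁, u₂, u₃, u₄ are new vertices and whether u₁u₂, u₂u₃, u₃u₄, u₄u₁ are new edges.
Profile : Set
Profile = Vec Bool 8

newVertices newEdges : Profile → ℕ
newVertices (a ∷ b ∷ c ∷ d ∷ _) = sum (map 𝟙 (a ∷ b ∷ c ∷ d ∷ []))
newEdges (_ ∷ _ ∷ _ ∷ _ ∷ p ∷ q ∷ r ∷ s ∷ []) = sum (map 𝟙 (p ∷ q ∷ r ∷ s ∷ []))

rotate : Profile → Profile
rotate (a ∷ b ∷ c ∷ d ∷ p ∷ q ∷ r ∷ s ∷ []) = b ∷ c ∷ d ∷ a ∷ q ∷ r ∷ s ∷ p ∷ []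

-- Both edges at a new vertex are new, some edge is new (the cycle is not contained in H_i)
-- and some edge is old (the cycle meets H_i in an edge).
Admissible : Profile → Set
Admissible (a ∷ b ∷ c ∷ d ∷ p ∷ q ∷ r ∷ s ∷ []) =
  (T a → T s × T p) × (T b → T p × T q) × (T c → T q × T r) × (T d → T r × T s) ×
  ¬ (¬ T p × ¬ T q × ¬ T r × ¬ T s) × ¬ (T p × T q × T r × T s)

admissible? : ∀ π → Dec (Admissible π)
admissible? (a ∷ b ∷ c ∷ d ∷ p ∷ q ∷ r ∷ s ∷ []) =
  (T? a →-dec T? s ×-dec T? p) ×-dec (T? b →-dec T? p ×-dec T? q) ×-dec
  (T? c →-dec T? q ×-dec T? r) ×-dec (T? d →-dec T? r ×-dec T? s) ×-dec
  ¬? (¬? (T? p) ×-dec ¬? (T? q) ×-dec ¬? (T? r) ×-dec ¬? (T? s)) ×-dec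
  ¬? (T? p ×-dec T? q ×-dec T? r ×-dec T? s)

AllEdgesNew : Profile → Set
AllEdgesNew (_ ∷ _ ∷ _ ∷ _ ∷ p ∷ q ∷ r ∷ s ∷ []) = T p × T q × T r × T s

allEdgesNew? : ∀ π → Dec (AllEdgesNew π)
allEdgesNew? (_ ∷ _ ∷ _ ∷ _ ∷ p ∷ q ∷ r ∷ s ∷ []) = T? p ×-dec T? q ×-dec T? r ×-dec T? s

A2Pattern : Profile → Set
A2Pattern (a ∷ b ∷ c ∷ d ∷ p ∷ _) = ¬ T a × ¬ T b × T c × T d × ¬ T p

a2Pattern? : ∀ π → Dec (A2Pattern π)
a2Pattern? (a ∷ b ∷ c ∷ d ∷ p ∷ _) = ¬? (T? a) ×-dec ¬? (T? b) ×-dec T? c ×-dec T? d ×-dec ¬? (T? p)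

A2Rotation : Profile → Set
A2Rotation π = A2Pattern π ⊎ A2Pattern (rotate π) ⊎ A2Pattern (rotate (rotate π)) ⊎
               A2Pattern (rotate (rotate (rotate π)))

a2Rotation? : ∀ π → Dec (A2Rotation π)
a2Rotation? π = a2Pattern? π ⊎-dec a2Pattern? (rotate π) ⊎-dec a2Pattern? (rotate (rotate π)) ⊎-dec
                a2Pattern? (rotate (rotate (rotate π)))

B3Pattern : Profile → Set
B3Pattern (_ ∷ _ ∷ c ∷ d ∷ p ∷ q ∷ _) = ¬ T p × T q × ¬ T c × T d

b3Pattern? : ∀ π → Dec (B3Pattern π)
b3Pattern? (_ ∷ _ ∷ c ∷ d ∷ p ∷ q ∷ _) = ¬? (T? p) ×-dec T? q ×-dec ¬? (T? c) ×-dec T? d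

-- Each of the following is decided by evaluating all 2⁸ profiles.

excess-first : ∀ π → AllEdgesNew π → 3 * newVertices π ≤ 2 * newEdges π + 4
excess-first = does-sound (∀-Vec? 8 λ π → allEdgesNew? π →-dec 3 * newVertices π ≤? 2 * newEdges π + 4) _

excess-nonneg : ∀ π → Admissible π → 3 * newVertices π ≤ 2 * newEdges π
excess-nonneg = does-sound (∀-Vec? 8 λ π → admissible? π →-dec 3 * newVertices π ≤? 2 * newEdges π) _

excess-pos-unless-A2 : ∀ π → Admissible π → A2Rotation π ⊎ 3 * newVertices π + 1 ≤ 2 * newEdges π
excess-pos-unless-A2 =
  does-sound (∀-Vec? 8 λ π → admissible? π →-dec (a2Rotation? π ⊎-dec 3 * newVertices π + 1 ≤? 2 * newEdges π)) _

excess-B3 : ∀ π → Admissible π → B3Pattern π → 3 * newVertices π + 3 ≤ 2 * newEdges π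
excess-B3 =
  does-sound (∀-Vec? 8 λ π → admissible? π →-dec b3Pattern? π →-dec 3 * newVertices π + 3 ≤? 2 * newEdges π) _

Distinct : ∀ {n} → Fin n → Fin n → Fin n → Fin n → Set
Distinct u₁ u₂ u₃ u₄ = u₁ ≢ u₂ × u₁ ≢ u₃ × u₁ ≢ u₄ × u₂ ≢ u₃ × u₂ ≢ u₄ × u₃ ≢ u₄

cycleEdges : ∀ {n} → Fin n → Fin n → Fin n → Fin n → List (Fin n × Fin n)
cycleEdges u₁ u₂ u₃ u₄ = (u₁ , u₂) ∷ (u₂ , u₃) ∷ (u₃ , u₄) ∷ (u₄ , u₁) ∷ []

cycleEdges-proper : ∀ {n} {u₁ u₂ u₃ u₄ : Fin n} → Distinct u₁ u₂ u₃ u₄ →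
                    All (uncurry _≢_) (cycleEdges u₁ u₂ u₃ u₄)
cycleEdges-proper (d₁₂ , d₁₃ , d₁₄ , d₂₃ , d₂₄ , d₃₄) = d₁₂ ∷ d₂₃ ∷ d₃₄ ∷ d₁₄ ∘ sym ∷ []

cycleEdges-apart : ∀ {n} {u₁ u₂ u₃ u₄ : Fin n} → Distinct u₁ u₂ u₃ u₄ →
                   AllPairs Apart (cycleEdges u₁ u₂ u₃ u₄)
cycleEdges-apart (d₁₂ , d₁₃ , d₁₄ , d₂₃ , d₂₄ , d₃₄) =
  (apart (d₁₂ ∘ proj₁) (d₁₃ ∘ proj₁) ∷ apart (d₁₃ ∘ proj₁) (d₁₄ ∘ proj₁) ∷ apart (d₁₄ ∘ proj₁) (d₂₄ ∘ proj₂) ∷ []) ∷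
  (apart (d₂₃ ∘ proj₁) (d₂₄ ∘ proj₁) ∷ apart (d₂₄ ∘ proj₁) (d₁₂ ∘ sym ∘ proj₁) ∷ []) ∷
  (apart (d₃₄ ∘ proj₁) (d₁₃ ∘ sym ∘ proj₁) ∷ []) ∷
  [] ∷ []

onEdges⇒QuadEdge : ∀ {n} {u₁ u₂ u₃ u₄ x y : Fin n} → T (onEdges (cycleEdges u₁ u₂ u₃ u₄) x y) →
                   QuadEdge u₁ u₂ u₃ u₄ x y
onEdges⇒QuadEdge {u₁ = u₁} {u₂} {u₃} {u₄} {x} {y} h
  with does-sound (Any.any? (λ e → endpoints? e x y) (cycleEdges u₁ u₂ u₃ u₄)) h
... | here e = inj₁ e
... | there (here e) = inj₂ (inj₁ e)
... | there (there (here e)) = inj₂ (inj₂ (inj₁ e))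
... | there (there (there (here e))) = inj₂ (inj₂ (inj₂ e))

QuadVertex⇒∈ : ∀ {n} {u₁ u₂ u₃ u₄ x : Fin n} → QuadVertex u₁ u₂ u₃ u₄ x →
               T (does (x ∈? (u₁ ∷ u₂ ∷ u₃ ∷ u₄ ∷ [])))
QuadVertex⇒∈ {u₁ = u₁} {u₂} {u₃} {u₄} {x} = does-complete (x ∈? (u₁ ∷ u₂ ∷ u₃ ∷ u₄ ∷ [])) ∘ member
  where
  member : QuadVertex u₁ u₂ u₃ u₄ x → Any (x ≡_) (u₁ ∷ u₂ ∷ u₃ ∷ u₄ ∷ [])
  member (inj₁ p) = here p
  member (inj₂ (inj₁ p)) = there (here p)
  member (inj₂ (inj₂ (inj₁ p))) = there (there (here p))
  member (inj₂ (inj₂ (inj₂ p))) = there (there (there (here p)))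

QuadEdge-sym : ∀ {n} {u₁ u₂ u₃ u₄ x y : Fin n} → QuadEdge u₁ u₂ u₃ u₄ x y → QuadEdge u₁ u₂ u₃ u₄ y x
QuadEdge-sym = Sum.map Endpoints-sym (Sum.map Endpoints-sym (Sum.map Endpoints-sym Endpoints-sym))

QuadEdge-elim : ∀ {n ℓ} {u₁ u₂ u₃ u₄ : Fin n} (R : Fin n → Fin n → Set ℓ) → (∀ {x y} → R x y → R y x) →
                R u₁ u₂ → R u₂ u₃ → R u₃ u₄ → R u₄ u₁ → ∀ {x y} → QuadEdge u₁ u₂ u₃ u₄ x y → R x y
QuadEdge-elim R R-sym r₁₂ r₂₃ r₃₄ r₄₁ = [ on r₁₂ , [ on r₂₃ , [ on r₃₄ , on r₄₁ ]′ ]′ ]′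
  where
  on : ∀ {a b x y} → R a b → Endpoints (a , b) x y → R x y
  on r (inj₁ (refl , refl)) = r
  on r (inj₂ (refl , refl)) = R-sym r

QuadVertex-elim : ∀ {n ℓ} {u₁ u₂ u₃ u₄ : Fin n} (P : Fin n → Set ℓ) →
                  P u₁ → P u₂ → P u₃ → P u₄ → ∀ {x} → QuadVertex u₁ u₂ u₃ u₄ x → P x
QuadVertex-elim P p₁ p₂ p₃ p₄ (inj₁ refl) = p₁
QuadVertex-elim P p₁ p₂ p₃ p₄ (inj₂ (inj₁ refl)) = p₂
QuadVertex-elim P p₁ p₂ p₃ p₄ (inj₂ (inj₂ (inj₁ refl))) = p₃
QuadVertex-elim P p₁ p₂ p₃ p₄ (inj₂ (inj₂ (inj₂ refl))) = p₄

QuadEdge-ends : ∀ {n} {u₁ u₂ u₃ u₄ x y : Fin n} → QuadEdge u₁ u₂ u₃ u₄ x y →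
                QuadVertex u₁ u₂ u₃ u₄ x × QuadVertex u₁ u₂ u₃ u₄ y
QuadEdge-ends {u₁ = u₁} {u₂} {u₃} {u₄} =
  QuadEdge-elim (λ x y → QuadVertex u₁ u₂ u₃ u₄ x × QuadVertex u₁ u₂ u₃ u₄ y) Product.swap
                (v₁ , v₂) (v₂ , v₃) (v₃ , v₄) (v₄ , v₁)
  where
  v₁ : QuadVertex u₁ u₂ u₃ u₄ u₁
  v₁ = inj₁ refl
  v₂ : QuadVertex u₁ u₂ u₃ u₄ u₂
  v₂ = inj₂ (inj₁ refl)
  v₃ : QuadVertex u₁ u₂ u₃ u₄ u₃
  v₃ = inj₂ (inj₂ (inj₁ refl))
  v₄ : QuadVertex u₁ u₂ u₃ u₄ u₄
  v₄ = inj₂ (inj₂ (inj₂ refl))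

module _ {n : ℕ} {G : Graph n} where

  cvertex? : (C : Cycle4 G) → ∀ x → Dec (CVertex C x)
  cvertex? C x = x ≟ c1 C ⊎-dec x ≟ c2 C ⊎-dec x ≟ c3 C ⊎-dec x ≟ c4 C

  cedge? : (C : Cycle4 G) → ∀ x y → Dec (CEdge C x y)
  cedge? C x y = endpoints? (c1 C , c2 C) x y ⊎-dec endpoints? (c2 C , c3 C) x y ⊎-dec
                 endpoints? (c3 C , c4 C) x y ⊎-dec endpoints? (c4 C , c1 C) x y

  Labelling-canonical : (C : Cycle4 G) → Labelling C (c1 C) (c2 C) (c3 C) (c4 C)
  Labelling-canonical C = (d12 C , d13 C , d14 C , d23 C , d24 C , d34 C) , λ x y → (λ e → e) , (λ e → e)

  Labelling-rotate : ∀ {C : Cycle4 G} {u₁ u₂ u₃ u₄} → Labelling C u₁ u₂ u₃ u₄ → Labelling C u₂ u₃ u₄ u₁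
  Labelling-rotate ((d₁₂ , d₁₃ , d₁₄ , d₂₃ , d₂₄ , d₃₄) , same) =
    (d₂₃ , d₂₄ , d₁₂ ∘ sym , d₃₄ , d₁₃ ∘ sym , d₁₄ ∘ sym) ,
    λ x y → rotate-⊎ ∘ proj₁ (same x y) , proj₂ (same x y) ∘ unrotate-⊎
    where
    rotate-⊎ : ∀ {A B C D : Set} → A ⊎ B ⊎ C ⊎ D → B ⊎ C ⊎ D ⊎ A
    rotate-⊎ (inj₁ a) = inj₂ (inj₂ (inj₂ a))
    rotate-⊎ (inj₂ (inj₁ b)) = inj₁ b
    rotate-⊎ (inj₂ (inj₂ (inj₁ c))) = inj₂ (inj₁ c)
    rotate-⊎ (inj₂ (inj₂ (inj₂ d))) = inj₂ (inj₂ (inj₁ d))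
    unrotate-⊎ : ∀ {A B C D : Set} → B ⊎ C ⊎ D ⊎ A → A ⊎ B ⊎ C ⊎ D
    unrotate-⊎ (inj₁ b) = inj₂ (inj₁ b)
    unrotate-⊎ (inj₂ (inj₁ c)) = inj₂ (inj₂ (inj₁ c))
    unrotate-⊎ (inj₂ (inj₂ (inj₁ d))) = inj₂ (inj₂ (inj₂ d))
    unrotate-⊎ (inj₂ (inj₂ (inj₂ a))) = inj₁ a

  Labelling⇒QuadVertex : ∀ {C : Cycle4 G} {u₁ u₂ u₃ u₄ x} → Labelling C u₁ u₂ u₃ u₄ →
                         CVertex C x → QuadVertex u₁ u₂ u₃ u₄ x
  Labelling⇒QuadVertex {C} {u₁} {u₂} {u₃} {u₄} (_ , same) =
    QuadVertex-elim (QuadVertex u₁ u₂ u₃ u₄)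
      (start (inj₁ e)) (start (inj₂ (inj₁ e))) (start (inj₂ (inj₂ (inj₁ e)))) (start (inj₂ (inj₂ (inj₂ e))))
    where
    e : ∀ {a b : Fin n} → Endpoints (a , b) a b
    e = inj₁ (refl , refl)
    start : ∀ {x y} → CEdge C x y → QuadVertex u₁ u₂ u₃ u₄ x
    start {x} {y} = proj₁ ∘ QuadEdge-ends ∘ proj₁ (same x y)

surplus-arith : ∀ {v v′ e e′ a b δ} → v′ ≤ v + a → e + b ≤ e′ → 3 * a + δ ≤ 2 * b →
                3 * v′ + 2 * e + δ ≤ 3 * v + 2 * e′
surplus-arith {v} {v′} {e} {e′} {a} {b} {δ} v′≤ ≤e′ excess = begin
  3 * v′ + 2 * e + δ          ≤⟨ +-monoˡ-≤ δ (+-monoˡ-≤ (2 * e) (*-monoʳ-≤ 3 v′≤)) ⟩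
  3 * (v + a) + 2 * e + δ     ≡⟨ regroup v a e δ ⟩
  3 * v + 2 * e + (3 * a + δ) ≤⟨ +-monoʳ-≤ (3 * v + 2 * e) excess ⟩
  3 * v + 2 * e + 2 * b       ≡⟨ factor v e b ⟩
  3 * v + 2 * (e + b)         ≤⟨ +-monoʳ-≤ (3 * v) (*-monoʳ-≤ 2 ≤e′) ⟩
  3 * v + 2 * e′              ∎
  where
  open ≤-Reasoning
  regroup : ∀ v a e δ → 3 * (v + a) + 2 * e + δ ≡ 3 * v + 2 * e + (3 * a + δ)
  regroup = solve-∀
  factor : ∀ v e b → 3 * v + 2 * e + 2 * b ≡ 3 * v + 2 * (e + b)
  factor = solve-∀

telescope-arith : ∀ {x x′ y y′ c r} → x′ + y + r ≤ x + y′ → x + c ≤ y + 4 → x′ + (c + r) ≤ y′ + 4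
telescope-arith {x} {x′} {y} {y′} {c} {r} step inv = +-cancelˡ-≤ (x + y) _ _ (begin
  x + y + (x′ + (c + r)) ≡⟨ regroup x x′ y c r ⟩
  x′ + y + r + (x + c)   ≤⟨ +-mono-≤ step inv ⟩
  x + y′ + (y + 4)       ≡⟨ regroup′ x y y′ ⟩
  x + y + (y′ + 4)       ∎)
  where
  open ≤-Reasoning
  regroup : ∀ x x′ y c r → x + y + (x′ + (c + r)) ≡ x′ + y + r + (x + c)
  regroup = solve-∀
  regroup′ : ∀ x y y′ → x + y′ + (y + 4) ≡ x + y + (y′ + 4)
  regroup′ = solve-∀

𝟙-<ᵇ-1 : ∀ {a} → 1 ≤ a → 𝟙 (a <ᵇ 1) ≡ 0
𝟙-<ᵇ-1 (s≤s z≤n) = refl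

𝟙-<ᵇ-suc : ∀ a m → 𝟙 (a <ᵇ suc m) ≡ 𝟙 (a <ᵇ m) + 𝟙 (a ≡ᵇ m)
𝟙-<ᵇ-suc zero zero = refl
𝟙-<ᵇ-suc zero (suc m) = refl
𝟙-<ᵇ-suc (suc a) zero = refl
𝟙-<ᵇ-suc (suc a) (suc m) = 𝟙-<ᵇ-suc a m

≡ᵇ-true⇒≡ : ∀ {a b} → (a ≡ᵇ b) ≡ true → a ≡ b
≡ᵇ-true⇒≡ {a} {b} eq = ≡ᵇ⇒≡ a b (T-≡ .from eq)

module Sequence {n : ℕ} {G : Graph n} (S : ConstructionSequence G) where

  private
    H : Fin (t S) → Cycle4 G
    H = cyc S

  VH? : ∀ m x → Dec (VH H m x)
  VH? m x = any? (λ k → toℕ k <? m ×-dec cvertex? (H k) x)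

  EH? : ∀ m x y → Dec (EH H m x y)
  EH? m x y = any? (λ k → toℕ k <? m ×-dec cedge? (H k) x y)

  V : ℕ → ℕ
  V m = countF (λ x → does (VH? m x))

  E : ℕ → ℕ
  E m = countPairs (λ x y → does (EH? m x y))

  newV : ℕ → Fin n → Bool
  newV m x = does (¬? (VH? m x))

  newE : ℕ → Fin n → Fin n → Bool
  newE m x y = does (¬? (EH? m x y))

  EH-sym : ∀ {m x y} → EH H m x y → EH H m y x
  EH-sym (k , k<m , e) = k , k<m , QuadEdge-sym e

  EH⇒VH : ∀ {m x y} → EH H m x y → VH H m x
  EH⇒VH (k , k<m , e) = k , k<m , proj₁ (QuadEdge-ends e)

  EH-suc : ∀ {m x y} → EH H m x y → EH H (suc m) x y
  EH-suc (k , k<m , e) = k , m≤n⇒m≤1+n k<m , e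

  VH-suc : ∀ (k : Fin (t S)) {x} → VH H (suc (toℕ k)) x → VH H (toℕ k) x ⊎ CVertex (H k) x
  VH-suc k (k′ , k′≤k , v) with m≤n⇒m<n∨m≡n (s≤s⁻¹ k′≤k)
  ... | inj₁ k′<k = inj₁ (k′ , k′<k , v)
  ... | inj₂ k′≡k rewrite toℕ-injective k′≡k = inj₂ v

  CEdge⇒EH : ∀ (k : Fin (t S)) {x y} → CEdge (H k) x y → EH H (suc (toℕ k)) x y
  CEdge⇒EH k e = k , ≤-refl , e

  VH-empty : ∀ {m x} → m ≡ 0 → ¬ VH H m x
  VH-empty refl (_ , () , _)

  EH-empty : ∀ {m x y} → m ≡ 0 → ¬ EH H m x y
  EH-empty refl (_ , () , _)

  new-vertex : ∀ {m x} → T (newV m x) → ¬ VH H m x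
  new-vertex {m} {x} = does-sound (¬? (VH? m x))

  new-edge : ∀ {m x y} → T (newE m x y) → ¬ EH H m x y
  new-edge {m} {x} {y} = does-sound (¬? (EH? m x y))

  old-vertex : ∀ {m x} → ¬ T (newV m x) → VH H m x
  old-vertex {m} {x} old = decidable-stable (VH? m x) (old ∘ does-complete (¬? (VH? m x)))

  old-edge : ∀ {m x y} → ¬ T (newE m x y) → EH H m x y
  old-edge {m} {x} {y} old = decidable-stable (EH? m x y) (old ∘ does-complete (¬? (EH? m x y)))

  newE-sym : ∀ {m x y} → T (newE m x y) → T (newE m y x)
  newE-sym {m} {x} {y} new = does-complete (¬? (EH? m y x)) (new-edge new ∘ EH-sym)

  newV⇒newE : ∀ {m x y} → T (newV m x) → T (newE m x y)
  newV⇒newE {m} {x} {y} new = does-complete (¬? (EH? m x y)) (new-vertex new ∘ EH⇒VH)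

  profile : ℕ → Fin n → Fin n → Fin n → Fin n → Profile
  profile m u₁ u₂ u₃ u₄ = newV m u₁ ∷ newV m u₂ ∷ newV m u₃ ∷ newV m u₄ ∷
                          newE m u₁ u₂ ∷ newE m u₂ u₃ ∷ newE m u₃ u₄ ∷ newE m u₄ u₁ ∷ []

  -- Step k lowers 3 v − 2 e by at least δ.
  Surplus : Fin (t S) → ℕ → Set
  Surplus k δ = 3 * V (suc (toℕ k)) + 2 * E (toℕ k) + δ ≤ 3 * V (toℕ k) + 2 * E (suc (toℕ k))

  module Step (k : Fin (t S)) {u₁ u₂ u₃ u₄ : Fin n} (L : Labelling (H k) u₁ u₂ u₃ u₄) where

    private
      m : ℕ
      m = toℕ k
      us : List (Fin n)
      us = u₁ ∷ u₂ ∷ u₃ ∷ u₄ ∷ []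
      es : List (Fin n × Fin n)
      es = cycleEdges u₁ u₂ u₃ u₄
      to-quad : ∀ {x y} → CEdge (H k) x y → QuadEdge u₁ u₂ u₃ u₄ x y
      to-quad {x} {y} = proj₁ (proj₂ L x y)
      from-quad : ∀ {x y} → QuadEdge u₁ u₂ u₃ u₄ x y → CEdge (H k) x y
      from-quad {x} {y} = proj₂ (proj₂ L x y)
      on-cycle : ∀ {x} → CVertex (H k) x → QuadVertex u₁ u₂ u₃ u₄ x
      on-cycle = Labelling⇒QuadVertex {C = H k} L

    π : Profile
    π = profile m u₁ u₂ u₃ u₄

    vertices-added : V (suc m) ≤ V m + newVertices π
    vertices-added = begin
      V (suc m)                                                   ≤⟨ countF-mono split ⟩
      countF (λ x → does (VH? m x) ∨ (newV m x ∧ does (x ∈? us))) ≤⟨ countF-∨ (λ x → does (VH? m x)) _ ⟩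
      V m + countF (λ x → newV m x ∧ does (x ∈? us))              ≤⟨ +-monoʳ-≤ (V m) (countF-∧-∈≤sum (newV m) us) ⟩
      V m + newVertices π                                         ∎
      where
      open ≤-Reasoning
      split : ∀ x → T (does (VH? (suc m) x)) → T (does (VH? m x) ∨ (newV m x ∧ does (x ∈? us)))
      split x h with VH? m x | VH-suc k (does-sound (VH? (suc m) x) h)
      ... | yes _ | _ = _
      ... | no ¬v | inj₁ v = ⊥-elim (¬v v)
      ... | no _ | inj₂ v = QuadVertex⇒∈ {u₁ = u₁} {u₂} {u₃} {u₄} (on-cycle v)

    edges-added : E m + newEdges π ≤ E (suc m)
    edges-added = begin
      E m + newEdges π
        ≤⟨ +-monoʳ-≤ (E m) (sum≤countPairs-onEdges (newE m) (λ _ _ → newE-sym) es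
                              (cycleEdges-proper (proj₁ L)) (cycleEdges-apart (proj₁ L))) ⟩
      E m + countPairs (λ x y → newE m x y ∧ onEdges es x y)
        ≤⟨ countPairs-∨-disjoint (λ x y → does (EH? m x y)) (λ x y → newE m x y ∧ onEdges es x y) disjoint ⟩
      countPairs (λ x y → does (EH? m x y) ∨ (newE m x y ∧ onEdges es x y))
        ≤⟨ countPairs-mono grow ⟩
      E (suc m)
        ∎
      where
      open ≤-Reasoning
      disjoint : ∀ x y → T (does (EH? m x y)) → ¬ T (newE m x y ∧ onEdges es x y)
      disjoint x y with EH? m x y
      ... | yes _ = λ _ ()
      ... | no _ = λ ()
      grow : ∀ x y → T (does (EH? m x y) ∨ (newE m x y ∧ onEdges es x y)) → T (does (EH? (suc m) x y))
      grow x y h with EH? m x y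
      ... | yes e = does-complete (EH? (suc m) x y) (EH-suc e)
      ... | no _ = does-complete (EH? (suc m) x y) (CEdge⇒EH k (from-quad (onEdges⇒QuadEdge h)))

    admissible : 1 ≤ m → Admissible π
    admissible 1≤m = incident , incident , incident , incident , some-edge-new , some-edge-old
      where
      incident : ∀ {x y z} → T (newV m y) → T (newE m x y) × T (newE m y z)
      incident new = newE-sym (newV⇒newE new) , newV⇒newE new
      some-edge-new : ¬ (¬ T (newE m u₁ u₂) × ¬ T (newE m u₂ u₃) × ¬ T (newE m u₃ u₄) × ¬ T (newE m u₄ u₁))
      some-edge-new (o₁₂ , o₂₃ , o₃₄ , o₄₁) = notSub S k 1≤m (vertices-old , edges-old)
        where
        edges-old : ∀ x y → CEdge (H k) x y → EH H m x y
        edges-old x y =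
          QuadEdge-elim (EH H m) EH-sym (old-edge o₁₂) (old-edge o₂₃) (old-edge o₃₄) (old-edge o₄₁) ∘ to-quad
        vertices-old : ∀ x → CVertex (H k) x → VH H m x
        vertices-old x = QuadVertex-elim {u₁ = u₁} {u₂} {u₃} {u₄} (VH H m)
          (EH⇒VH (old-edge o₁₂)) (EH⇒VH (old-edge o₂₃)) (EH⇒VH (old-edge o₃₄)) (EH⇒VH (old-edge o₄₁)) ∘ on-cycle
      some-edge-old : ¬ (T (newE m u₁ u₂) × T (newE m u₂ u₃) × T (newE m u₃ u₄) × T (newE m u₄ u₁))
      some-edge-old (n₁₂ , n₂₃ , n₃₄ , n₄₁) with meets S k 1≤m
      ... | x , y , e , old = QuadEdge-elim (λ x y → ¬ EH H m x y) (_∘ EH-sym)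
        (new-edge n₁₂) (new-edge n₂₃) (new-edge n₃₄) (new-edge n₄₁) (to-quad e) old

    surplus : ∀ {δ} → 3 * newVertices π + δ ≤ 2 * newEdges π → Surplus k δ
    surplus = surplus-arith {V m} {V (suc m)} {E m} {E (suc m)} vertices-added edges-added

    A2Pattern⇒TypeA2 : A2Pattern π → TypeA2 S k
    A2Pattern⇒TypeA2 (o₁ , o₂ , n₃ , n₄ , o₁₂) =
      u₁ , u₂ , u₃ , u₄ , L , old-vertex o₁ , old-vertex o₂ , old-edge o₁₂ , new-vertex n₃ , new-vertex n₄

    B3Pattern-intro : EH H m u₁ u₂ → ¬ EH H m u₂ u₃ → VH H m u₃ → ¬ VH H m u₄ → B3Pattern π
    B3Pattern-intro e₁₂ ¬e₂₃ v₃ ¬v₄ =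
      (λ new → new-edge new e₁₂) , does-complete (¬? (EH? m u₂ u₃)) ¬e₂₃ ,
      (λ new → new-vertex new v₃) , does-complete (¬? (VH? m u₄)) ¬v₄

  step-surplus : ∀ k → 1 ≤ toℕ k → Surplus k 0
  step-surplus k 1≤k = surplus (≤-trans (≤-reflexive (+-identityʳ _)) (excess-nonneg π (admissible 1≤k)))
    where open Step k (Labelling-canonical (H k))

  A2-or-surplus : ∀ k → 1 ≤ toℕ k → TypeA2 S k ⊎ Surplus k 1
  A2-or-surplus k 1≤k = classify (excess-pos-unless-A2 π (admissible 1≤k))
    where
    L₀ : Labelling (H k) (c1 (H k)) (c2 (H k)) (c3 (H k)) (c4 (H k))
    L₀ = Labelling-canonical (H k)
    open Step k L₀
    rot : ∀ {u₁ u₂ u₃ u₄} → Labelling (H k) u₁ u₂ u₃ u₄ → Labelling (H k) u₂ u₃ u₄ u₁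
    rot = Labelling-rotate {C = H k}
    classify : A2Rotation π ⊎ 3 * newVertices π + 1 ≤ 2 * newEdges π → TypeA2 S k ⊎ Surplus k 1
    classify (inj₁ (inj₁ p)) = inj₁ (A2Pattern⇒TypeA2 p)
    classify (inj₁ (inj₂ (inj₁ p))) = inj₁ (Step.A2Pattern⇒TypeA2 k (rot L₀) p)
    classify (inj₁ (inj₂ (inj₂ (inj₁ p)))) = inj₁ (Step.A2Pattern⇒TypeA2 k (rot (rot L₀)) p)
    classify (inj₁ (inj₂ (inj₂ (inj₂ p)))) = inj₁ (Step.A2Pattern⇒TypeA2 k (rot (rot (rot L₀))) p)
    classify (inj₂ excess) = inj₂ (surplus excess)

  B3-surplus : ∀ k → 1 ≤ toℕ k → TypeB3 S k → Surplus k 3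
  B3-surplus k 1≤k (u₁ , u₂ , u₃ , u₄ , L , e₁₂ , ¬e₂₃ , v₃ , _ , ¬v₄) =
    surplus (excess-B3 π (admissible 1≤k) (B3Pattern-intro e₁₂ ¬e₂₃ v₃ ¬v₄))
    where open Step k L

  first-cycle : ∀ k → toℕ k ≡ 0 → 3 * V (suc (toℕ k)) ≤ 2 * E (suc (toℕ k)) + 4
  first-cycle k k≡0 = begin
    3 * V (suc m)              ≤⟨ *-monoʳ-≤ 3 vertices-added ⟩
    3 * (V m + newVertices π)  ≡⟨ cong (λ v → 3 * (v + newVertices π)) no-vertices ⟩
    3 * newVertices π          ≤⟨ excess-first π (new _ _ , new _ _ , new _ _ , new _ _) ⟩
    2 * newEdges π + 4         ≤⟨ +-monoˡ-≤ 4 (*-monoʳ-≤ 2 (m≤n+m (newEdges π) (E m))) ⟩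
    2 * (E m + newEdges π) + 4 ≤⟨ +-monoˡ-≤ 4 (*-monoʳ-≤ 2 edges-added) ⟩
    2 * E (suc m) + 4          ∎
    where
    open ≤-Reasoning
    open Step k (Labelling-canonical (H k))
    m : ℕ
    m = toℕ k
    no-vertices : V m ≡ 0
    no-vertices = countF-none {f = λ x → does (VH? m x)} (λ x → VH-empty k≡0 ∘ does-sound (VH? m x))
    new : ∀ x y → T (newE m x y)
    new x y = does-complete (¬? (EH? m x y)) (EH-empty k≡0)

  step-at : ∀ {ℓ} (P : ℕ → Set ℓ) {m} → m < t S → (∀ k → toℕ k ≡ m → P (toℕ k)) → P m
  step-at P m<t f = subst P (toℕ-fromℕ< m<t) (f (fromℕ< m<t) (toℕ-fromℕ< m<t))

  module Credit (i j : Fin (t S)) (1≤i : 1 ≤ toℕ i) (1≤j : 1 ≤ toℕ j) (j≢i : j ≢ i)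
                (surplus-i : Surplus i 3) (surplus-j : Surplus j 1) where

    -- reward m is the surplus guaranteed at step m, and credit m = reward 0 + ⋯ + reward (m − 1).
    reward : ℕ → ℕ
    reward m = 3 * 𝟙 (toℕ i ≡ᵇ m) + 𝟙 (toℕ j ≡ᵇ m)

    credit : ℕ → ℕ
    credit m = 3 * 𝟙 (toℕ i <ᵇ m) + 𝟙 (toℕ j <ᵇ m)

    credit-suc : ∀ m → credit (suc m) ≡ credit m + reward m
    credit-suc m rewrite 𝟙-<ᵇ-suc (toℕ i) m | 𝟙-<ᵇ-suc (toℕ j) m =
      regroup (𝟙 (toℕ i <ᵇ m)) (𝟙 (toℕ i ≡ᵇ m)) (𝟙 (toℕ j <ᵇ m)) (𝟙 (toℕ j ≡ᵇ m))
      where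
      regroup : ∀ a b c d → 3 * (a + b) + (c + d) ≡ 3 * a + c + (3 * b + d)
      regroup = solve-∀

    reward-surplus : ∀ k → 1 ≤ toℕ k → Surplus k (reward (toℕ k))
    reward-surplus k 1≤k with toℕ i ≡ᵇ toℕ k in i≡k | toℕ j ≡ᵇ toℕ k in j≡k
    ... | true | true = ⊥-elim (j≢i (toℕ-injective (trans (≡ᵇ-true⇒≡ j≡k) (sym (≡ᵇ-true⇒≡ i≡k)))))
    ... | true | false = subst (λ k → Surplus k 3) (toℕ-injective (≡ᵇ-true⇒≡ i≡k)) surplus-i
    ... | false | true = subst (λ k → Surplus k 1) (toℕ-injective (≡ᵇ-true⇒≡ j≡k)) surplus-j
    ... | false | false = step-surplus k 1≤k

    Invariant : ℕ → Set
    Invariant m = 3 * V m + credit m ≤ 2 * E m + 4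

    invariant-first : ∀ k → toℕ k ≡ 0 → Invariant (suc (toℕ k))
    invariant-first k k≡0 = begin
      3 * V (suc (toℕ k)) + credit (suc (toℕ k)) ≡⟨ cong (λ c → 3 * V (suc (toℕ k)) + c) no-credit ⟩
      3 * V (suc (toℕ k)) + 0                    ≡⟨ +-identityʳ _ ⟩
      3 * V (suc (toℕ k))                        ≤⟨ first-cycle k k≡0 ⟩
      2 * E (suc (toℕ k)) + 4                    ∎
      where
      open ≤-Reasoning
      no-credit : credit (suc (toℕ k)) ≡ 0
      no-credit rewrite k≡0 = cong₂ (λ a b → 3 * a + b) (𝟙-<ᵇ-1 1≤i) (𝟙-<ᵇ-1 1≤j)

    invariant-step : ∀ k → 1 ≤ toℕ k → Invariant (toℕ k) → Invariant (suc (toℕ k))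
    invariant-step k 1≤k inv rewrite credit-suc (toℕ k) =
      telescope-arith {3 * V (toℕ k)} {3 * V (suc (toℕ k))} {2 * E (toℕ k)} {2 * E (suc (toℕ k))} {credit (toℕ k)}
                      (reward-surplus k 1≤k) inv

    invariant : ∀ m → suc m ≤ t S → Invariant (suc m)
    invariant zero 0<t = step-at (Invariant ∘ suc) 0<t invariant-first
    invariant (suc m) m+1<t = step-at (Invariant ∘ suc) m+1<t λ k k≡m+1 →
      invariant-step k (subst (1 ≤_) (sym k≡m+1) (s≤s z≤n))
                     (subst Invariant (sym k≡m+1) (invariant m (<⇒≤ m+1<t)))

    dense : 3 * V (t S) ≤ 2 * E (t S)
    dense = +-cancelʳ-≤ 4 _ _ (subst (λ c → 3 * V (t S) + c ≤ 2 * E (t S) + 4) full-credit (final (t≥1 S) ≤-refl))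
      where
      final : ∀ {m} → 1 ≤ m → m ≤ t S → Invariant m
      final {suc m} _ = invariant m
      full-credit : credit (t S) ≡ 4
      full-credit = cong₂ (λ a b → 3 * a + b) (𝟙-T (<⇒<ᵇ (toℕ<n i))) (𝟙-T (<⇒<ᵇ (toℕ<n j)))

  G-as-subgraph : Subgraph G
  G-as-subgraph = record
    { vJ = λ _ → true ; eJ = adj G ; eSym = Graph.sym G ; eAdj = λ _ _ e → e ; eEnds = λ _ _ _ → refl }

  sparse : mLessThreeHalves G → 2 * E (t S) < 3 * V (t S)
  sparse m<3/2 = begin-strict
    2 * E (t S)              ≤⟨ *-monoʳ-≤ 2 (countPairs-mono in-G) ⟩
    2 * ecount G-as-subgraph <⟨ m<3/2 G-as-subgraph nonempty ⟩
    3 * vcount G-as-subgraph ≤⟨ *-monoʳ-≤ 3 (countF-mono (λ x _ → does-complete (VH? (t S) x) (lastV S x))) ⟩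
    3 * V (t S)              ∎
    where
    open ≤-Reasoning
    in-G : ∀ x y → T (does (EH? (t S) x y)) → T (adj G x y)
    in-G x y e = T-≡ .from (proj₂ (lastE S x y) (does-sound (EH? (t S) x y) e))
    nonempty : 1 ≤ vcount G-as-subgraph
    nonempty = term≤sumF (λ _ → 1) (c1 (H (fromℕ< (t≥1 S))))

proposition23 : ∀ {n : ℕ} (G : Graph n) → IsC4Component G → mLessThreeHalves G →
    (S : ConstructionSequence G) →
    ∀ (i : Fin (t S)) → 1 ≤ toℕ i → TypeB3 S i →
    ∀ (j : Fin (t S)) → 1 ≤ toℕ j → j ≢ i → TypeA2 S j
proposition23 G _ m<3/2 S i 1≤i b3 j 1≤j j≢i with Sequence.A2-or-surplus S j 1≤j
... | inj₁ a2 = a2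
... | inj₂ surplus-j = ⊥-elim (<⇒≱ (sparse m<3/2) dense)
  where
  open Sequence S
  open Credit i j 1≤i 1≤j j≢i (B3-surplus i 1≤i b3) surplus-j
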